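{- $(\mathrm{FFT},\mathrm{destruct})$ is a final $\mathcal{T}$-coalgebra: for every coalgebra $(C,\alpha)$ with $\alpha:C\to\mathcal{T}(C)$ there exists exactly one function $f:C\to\mathrm{FFT}$ with $\mathrm{destruct}\circ f=\mathcal{T}(f)\circ\alpha$.
   Context: Words are finite sequences of natural numbers; $\mathbb{N}^*$ is the set of words, $\epsilon$ the empty word, $\mathbb{N}^+$ the nonempty words; concatenation is juxtaposition; $\sqsubseteq$ is the prefix order ($\sqsubset$ strict). A tree is a prefix-closed set of words (nodes) with a labelling function $\ell$; trees are finitely branching: each node $w$ has an arity $k$ with $wi$ a node iff $i<k$; leaves are $\sqsubseteq$-maximal nodes. Fix a set $A$ of labels and an object $*\notin A$. A finite tree with non-wellfounded leaves is a finite tree $\iota$ labelled in $A\cup\{*\}$ whose root is not labelled $*$ and whose $*$-labelled nodes are all leaves; $\mathrm{nwleaf}(\iota)$ is its set of $*$-labelled nodes; $\mathrm{NWT}$ is the set of such trees. The endofunctor $\mathcal{T}$ on the category of sets: $\mathcal{T}(X)=\{(\iota,\mu):\iota\in\mathrm{NWT},\ \mu:\mathrm{nwleaf}(\iota)\to X\}$ and $\mathcal{T}(f)(\iota,\mu)=(\iota,f\circ\mu)$. A set $F\subseteq\mathbb{N}^*$ has the fragmentation properties if it is finite, has a $\sqsubseteq$-minimum, and is convex (if $w,v\in F$ and $w\sqsubseteq u\sqsubseteq v$ then $u\in F$). A finite-fragmented tree is a pair $\pi=(\tau,\mathcal{F})$ where $\tau$ is a (possibly infinite, finitely branching) tree labelled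 in $A$ and $\mathcal{F}$ is a partition of its nodes into sets with the fragmentation properties; $\sim^\pi$ is the associated equivalence relation; $\mathrm{FFT}$ is the set of all finite-fragmented trees. $\mathrm{roots}(\pi)$ is the set of minima of the blocks of $\mathcal{F}$. For roots $w,v$: $w\lhd v$ iff $w\sqsubset v$ and there is no root $u$ with $w\sqsubset u\sqsubset v$. For $w\in\mathrm{roots}(\pi)$: the tree fragment $\mathrm{tf}(\pi,w)\in\mathrm{NWT}$ has node set $\{v\in\mathbb{N}^*: w\sim^\pi wv\}\cup\{u\in\mathbb{N}^+: w\lhd wu\}$, with label $\ell^\pi(wv)$ at $v$ if $w\sim^\pi wv$ and $*$ at $u$ if $w\lhd wu$; the subtree $\mathrm{st}(\pi,w)$ is the finite-fragmented tree with nodes $\{v: wv \text{ is a node of }\pi\}$, labels $v\mapsto\ell^\pi(wv)$, and $v\sim u$ iff $wv\sim^\pi wu$. $\mathrm{destruct}:\mathrm{FFT}\to\mathcal{T}(\mathrm{FFT})$ is $\pi\mapsto(\mathrm{tf}(\pi,\epsilon),\ w\mapsto\mathrm{st}(\pi,w))$. -}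

module Defs where

open import Data.Nat using (ℕ; _<_)
open import Data.List using (List; []; _∷_; _++_; [_])
open import Data.List.Membership.Propositional using (_∈_)
open import Data.Bool using (Bool; true; false; _∧_; T)
open import Data.Maybe using (Maybe; just; nothing; is-nothing)
open import Data.Product using (Σ; _×_; _,_; proj₁; proj₂)
open import Data.Sum using (_⊎_; inj₁; inj₂)
open import Data.Empty using (⊥)
open import Relation.Nullary using (¬_)
open import Relation.Binary.PropositionalEquality using (_≡_; _≢_)

module _ (A : Set) where

  Word : Set
  Word = List ℕ

  _⊑_ : Word → Word → Set
  w ⊑ v = Σ Word λ u → w ++ u ≡ v

  _⊏_ : Word → Word → Set
  w ⊏ v = w ⊑ v × w ≢ v

  _⟺_ : Set → Set → Set
  P ⟺ Q = (P → Q) × (Q → P)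

  Finite : (Word → Set) → Set
  Finite P = Σ (List Word) λ xs → ∀ w → P w ⟺ (w ∈ xs)

  record LTree (L : Set) : Set₁ where
    field
      node  : Word → Set
      label : (w : Word) → node w → L
  open LTree public

  record IsTree {L : Set} (t : LTree L) : Set where
    field
      root               : node t []
      prefix-closed      : ∀ {w v} → w ⊑ v → node t v → node t w
      finitely-branching : ∀ {w} → node t w →
                           Σ ℕ λ k → ∀ i → node t (w ++ [ i ]) ⟺ (i < k)
      label-irrelevant   : ∀ w (p q : node t w) → label t w p ≡ label t w q

  IsLeaf : {L : Set} → LTree L → Word → Set
  IsLeaf t w = node t w × (∀ v → node t v → w ⊑ v → w ≡ v)

  _≈t_ : {L : Set} → LTree L → LTree L → Set
  t ≈t s = (∀ w → node t w ⟺ node s w)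
         × (∀ w (p : node t w) (q : node s w) → label t w p ≡ label s w q)

  -- Labels are in A ∪ {*}, encoded as Maybe A with * = nothing.
  -- Since such a tree is finite, its node set is decidable; we represent it
  -- by a Boolean predicate (the labelling is then a total function whose
  -- values outside the node set are irrelevant).

  record NWTree : Set where
    field
      nnode  : Word → Bool
      nlabel : Word → Maybe A
  open NWTree public

  toLTree : NWTree → LTree (Maybe A)
  toLTree ι = record { node = λ w → T (nnode ι w) ; label = λ w _ → nlabel ι w }

  record IsNWT (ι : NWTree) : Set where
    field
      isTree      : IsTree (toLTree ι)
      finite      : Finite (λ w → T (nnode ι w))
      root-not-*  : nlabel ι [] ≢ nothing
      *-are-leaves : ∀ w → T (nnode ι w) → nlabel ι w ≡ nothing → IsLeaf (toLTree ι) w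

  NWT : Set
  NWT = Σ NWTree IsNWT

  nwleaf : NWTree → Word → Set
  nwleaf ι w = T (nnode ι w ∧ is-nothing (nlabel ι w))

  𝒯 : Set₁ → Set₁
  𝒯 X = Σ NWT λ ι → (w : Word) → nwleaf (proj₁ ι) w → X

  𝒯map : {X Y : Set₁} → (X → Y) → 𝒯 X → 𝒯 Y
  𝒯map f (ι , μ) = ι , λ w p → f (μ w p)

  -- Finite-fragmented trees.
  -- The partition 𝓕 of the nodes is given by its equivalence relation ~
  -- (the blocks of 𝓕 are the equivalence classes).

  record FragmentationProps (F : Word → Set) : Set where
    field
      finite  : Finite F
      minimum : Σ Word λ m → F m × (∀ v → F v → m ⊑ v)
      convex  : ∀ w u v → F w → F v → w ⊑ u → u ⊑ v → F u

  record RawFFT : Set₁ where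
    field
      tree : LTree A
      _~_  : Word → Word → Set
  open RawFFT public

  record IsFFT (π : RawFFT) : Set where
    field
      isTree   : IsTree (tree π)
      ~-nodes  : ∀ {w v} → _~_ π w v → node (tree π) w × node (tree π) v
      ~-refl   : ∀ {w} → node (tree π) w → _~_ π w w
      ~-sym    : ∀ {w v} → _~_ π w v → _~_ π v w
      ~-trans  : ∀ {w v u} → _~_ π w v → _~_ π v u → _~_ π w u
      blocks   : ∀ w → node (tree π) w → FragmentationProps (λ v → _~_ π w v)

  FFT : Set₁
  FFT = Σ RawFFT IsFFT

  _≈F_ : RawFFT → RawFFT → Set
  π ≈F ρ = (tree π ≈t tree ρ) × (∀ w v → _~_ π w v ⟺ _~_ ρ w v)

  _≈FFT_ : FFT → FFT → Set
  π ≈FFT ρ = proj₁ π ≈F proj₁ ρ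

  module _ (π : FFT) where
    private
      τ = tree (proj₁ π)
      _∼_ = _~_ (proj₁ π)

    IsRoot : Word → Set
    IsRoot w = node τ w × (∀ v → w ∼ v → w ⊑ v)

    _◁_ : Word → Word → Set
    w ◁ v = IsRoot w × IsRoot v × w ⊏ v
          × (∀ u → IsRoot u → w ⊏ u → u ⊏ v → ⊥)

    tf : Word → LTree (Maybe A)
    tf w = record
      { node  = λ v → (w ∼ (w ++ v)) ⊎ ((v ≢ []) × (w ◁ (w ++ v)))
      ; label = lab }
      where
      lab : (v : Word) → (w ∼ (w ++ v)) ⊎ ((v ≢ []) × (w ◁ (w ++ v))) → Maybe A
      lab v (inj₁ p) = just (label τ (w ++ v) (proj₂ (IsFFT.~-nodes (proj₂ π) p)))
      lab v (inj₂ _) = nothing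

    st : Word → RawFFT
    st w = record
      { tree = record { node = λ v → node τ (w ++ v)
                      ; label = λ v p → label τ (w ++ v) p }
      ; _~_ = λ v u → (w ++ v) ∼ (w ++ u) }

  nwleafL : LTree (Maybe A) → Word → Set
  nwleafL t w = Σ (node t w) λ p → label t w p ≡ nothing

  destruct : FFT → Σ (LTree (Maybe A)) λ t → (w : Word) → nwleafL t w → RawFFT
  destruct π = tf π [] , λ w _ → st π w

  _≈𝒯_ : (Σ (LTree (Maybe A)) λ t → (w : Word) → nwleafL t w → RawFFT) → 𝒯 FFT → Set
  (t , μ) ≈𝒯 ((ι , _) , ν) =
    (t ≈t toLTree ι)
    × (∀ w (p : nwleafL t w) (q : nwleaf ι w) → μ w p ≈F proj₁ (ν w q))

  IsCoalgebraMorphism : {C : Set₁} → (C → 𝒯 C) → (C → FFT) → Set₁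
  IsCoalgebraMorphism α f = ∀ c → destruct (f c) ≈𝒯 𝒯map f (α c)

{-# OPTIONS --safe #-}
-- The morphism unfolds c : C by gluing: its root fragment is the finite tree ι of α c, and at
-- each *-leaf u of ι hangs, rooted at u, the unfolding of the element that α attaches to u.
-- Concretely a word w is followed through ι, jumping into the next fragment whenever a *-leaf
-- is crossed; w is a node if this walk succeeds, and two nodes share a block iff their walks
-- end in the same fragment.
-- Uniqueness: every node of a finite-fragmented tree π lies either in the root block or below
-- a child u of the root (ε ◁ u), and destruct π fixes the root block (it is tf(π, ε)) and the
-- subtrees at those children. Two coalgebra morphisms therefore agree on all words of length
-- below n, by induction on n, because the children of the root are nonempty words.
module Submission where

open import Data.Bool using (true; false; T; _∧_)
open import Data.Bool.Properties using (T-irrelevant)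
open import Data.Empty using (⊥; ⊥-elim)
open import Data.List using (List; []; _∷_; _++_; [_]; _∷ʳ_; length; filter)
import Data.List as List
open import Data.List.Membership.Propositional using (_∈_)
open import Data.List.Membership.Propositional.Properties using (∈-map⁺; ∈-map⁻; ∈-filter⁺; ∈-filter⁻)
open import Data.List.Properties
  using ( ≡-dec; ++-assoc; ++-cancelˡ; ++-identityʳ; ++-identityʳ-unique; ++-conicalˡ; ++-conicalʳ
        ; ∷-injective; length-++-≤ʳ)
open import Data.List.Reverse using (Reverse; reverseView; []; _∶_∶ʳ_)
open import Data.Maybe using (Maybe; just; nothing; is-just; is-nothing; map; _>>=_)
open import Data.Maybe.Properties using (just-injective; map-just; map-injective; map-∘)
open import Data.Nat using (ℕ; suc; _≤_; _<_; s≤s; _≟_)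
open import Data.Nat.Properties using (<-≤-trans; n<1+n)
open import Data.Product using (Σ; _×_; _,_; proj₁; proj₂)
open import Data.Sum using (_⊎_; inj₁; inj₂)
open import Function using (_∘_)
open import Relation.Nullary using (¬_)
open import Relation.Nullary.Decidable using (Dec; T?; yes; no)
open import Relation.Binary.PropositionalEquality
  using (_≡_; _≢_; refl; sym; trans; cong; subst; module ≡-Reasoning)

open import Defs

module _ {ℓ} {X : Set ℓ} where

  extract : (m : Maybe X) → T (is-just m) → X
  extract (just x) _ = x

  ≡just-extract : ∀ m p → m ≡ just (extract m p)
  ≡just-extract (just x) _ = refl

  extract-≡ : ∀ {m x} → m ≡ just x → ∀ p → extract m p ≡ x
  extract-≡ refl _ = refl

  ≡just⇒is-just : ∀ {m : Maybe X} {x} → m ≡ just x → T (is-just m)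
  ≡just⇒is-just refl = _

  is-just-map : ∀ {ℓ′} {Y : Set ℓ′} (f : X → Y) m → is-just (map f m) ≡ is-just m
  is-just-map f (just _) = refl
  is-just-map f nothing  = refl

module _ (A : Set) where

  ⊑-refl : ∀ w → _⊑_ A w w
  ⊑-refl w = [] , ++-identityʳ w

  ⊑-trans : ∀ {u v w} → _⊑_ A u v → _⊑_ A v w → _⊑_ A u w
  ⊑-trans {u} (d , refl) (e , refl) = d ++ e , sym (++-assoc u d e)

  ⊑-antisym : ∀ {u v} → _⊑_ A u v → _⊑_ A v u → u ≡ v
  ⊑-antisym {u} (d , refl) (e , u++d++e≡u) =
    sym (trans (cong (u ++_) d≡[]) (++-identityʳ u))
    where
    d≡[] : d ≡ []
    d≡[] = ++-conicalˡ d e (++-identityʳ-unique u (sym (trans (sym (++-assoc u d e)) u++d++e≡u)))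

  []⊑ : ∀ w → _⊑_ A [] w
  []⊑ w = w , refl

  ⊑-++ : ∀ u v → _⊑_ A u (u ++ v)
  ⊑-++ u v = v , refl

  ∷-⊑ : ∀ x {u v} → _⊑_ A u v → _⊑_ A (x ∷ u) (x ∷ v)
  ∷-⊑ x (d , refl) = d , refl

  ≢-∷ʳ : ∀ (w : Word A) i → w ≢ w ∷ʳ i
  ≢-∷ʳ w i w≡w∷ʳi with ++-identityʳ-unique w w≡w∷ʳi
  ... | ()

  ∷ʳ≢[] : ∀ (w : Word A) i → w ∷ʳ i ≢ []
  ∷ʳ≢[] w i w∷ʳi≡[] with ++-conicalʳ w [ i ] w∷ʳi≡[]
  ... | ()

  length-++-<ʳ : ∀ {u : Word A} v → u ≢ [] → length v < length (u ++ v)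
  length-++-<ʳ {[]}    v u≢[] = ⊥-elim (u≢[] refl)
  length-++-<ʳ {_ ∷ u} v _    = s≤s (length-++-≤ʳ v {u})

  ⊑-comparable : ∀ {u v w} → _⊑_ A u w → _⊑_ A v w → _⊑_ A u v ⊎ _⊑_ A v u
  ⊑-comparable {[]} {v} _ _ = inj₁ ([]⊑ v)
  ⊑-comparable {_ ∷ _} {[]} _ _ = inj₂ ([]⊑ _)
  ⊑-comparable {x ∷ u} {y ∷ v} (d , refl) (e , y∷v++e≡x∷u++d) with ∷-injective y∷v++e≡x∷u++d
  ... | refl , v++e≡u++d with ⊑-comparable {u} {v} (d , refl) (e , v++e≡u++d)
  ...   | inj₁ u⊑v = inj₁ (∷-⊑ x u⊑v)
  ...   | inj₂ v⊑u = inj₂ (∷-⊑ x v⊑u)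

  ⊑-∷ʳ : ∀ {u} w i → _⊑_ A u (w ∷ʳ i) → _⊑_ A u w ⊎ u ≡ w ∷ʳ i
  ⊑-∷ʳ {[]} w i _ = inj₁ ([]⊑ w)
  ⊑-∷ʳ {x ∷ u} [] i (d , x∷u++d≡[i]) with ∷-injective x∷u++d≡[i]
  ... | refl , u++d≡[] with ++-conicalˡ u d u++d≡[]
  ...   | refl = inj₂ refl
  ⊑-∷ʳ {x ∷ u} (y ∷ w) i (d , x∷u++d≡y∷w∷ʳi) with ∷-injective x∷u++d≡y∷w∷ʳi
  ... | refl , u++d≡w∷ʳi with ⊑-∷ʳ w i (d , u++d≡w∷ʳi)
  ...   | inj₁ u⊑w = inj₁ (∷-⊑ x u⊑w)
  ...   | inj₂ u≡w∷ʳi = inj₂ (cong (x ∷_) u≡w∷ʳi)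

  Labelled : NWTree A → Word A → A → Set
  Labelled ι u a = T (nnode ι u) × nlabel ι u ≡ just a

  nwleaf-intro : ∀ ι u → T (nnode ι u) → nlabel ι u ≡ nothing → nwleaf A ι u
  nwleaf-intro ι u = intro
    where
    intro : ∀ {b} {m : Maybe A} → T b → m ≡ nothing → T (b ∧ is-nothing m)
    intro {true} _ refl = _

  nwleaf-elim : ∀ ι u → nwleaf A ι u → T (nnode ι u) × nlabel ι u ≡ nothing
  nwleaf-elim ι u = elim
    where
    elim : ∀ {b} {m : Maybe A} → T (b ∧ is-nothing m) → T b × m ≡ nothing
    elim {true} {nothing} _ = _ , refl

  data Shape (ι : NWTree A) (u : Word A) : Set where
    outside  : ¬ T (nnode ι u) → Shape ι u
    inner    : ∀ a → Labelled ι u a → Shape ι u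
    starred  : nwleaf A ι u → Shape ι u

  shape : ∀ ι u → Shape ι u
  shape ι u with nnode ι u in isNode | nlabel ι u in lab
  ... | false | _      = outside (subst T isNode)
  ... | true  | just a  = inner a (subst T (sym isNode) _ , lab)
  ... | true  | nothing = starred (nwleaf-intro ι u (subst T (sym isNode) _) lab)

  module _ {ι : NWTree A} (isNWT : IsNWT A ι) where
    open IsNWT isNWT

    ∗-maximal : ∀ {u v} → T (nnode ι u) → nlabel ι u ≡ nothing → T (nnode ι v) → _⊑_ A u v → u ≡ v
    ∗-maximal {u} {v} u∈ι u∗ v∈ι = proj₂ (*-are-leaves u u∈ι u∗) v v∈ι

    nwleaf≢[] : ∀ {u} → nwleaf A ι u → u ≢ []
    nwleaf≢[] q refl = root-not-* (proj₂ (nwleaf-elim ι [] q))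

    root-labelled : Σ A (Labelled ι [])
    root-labelled with nlabel ι [] in lab
    ... | just a  = a , IsTree.root isTree , refl
    ... | nothing = ⊥-elim (root-not-* lab)

    proper-prefix-labelled : ∀ {u v} → T (nnode ι v) → _⊑_ A u v → u ≢ v → Σ A (Labelled ι u)
    proper-prefix-labelled {u} v∈ι u⊑v u≢v with nlabel ι u in lab
    ... | just a  = a , u∈ι , refl
      where u∈ι = IsTree.prefix-closed isTree u⊑v v∈ι
    ... | nothing = ⊥-elim (u≢v (∗-maximal (IsTree.prefix-closed isTree u⊑v v∈ι) lab v∈ι u⊑v))

    prefix-labelled : ∀ {u v a} → Labelled ι v a → _⊑_ A u v → Σ A (Labelled ι u)
    prefix-labelled {u} (v∈ι , labv) u⊑v with nlabel ι u in lab
    ... | just b  = b , IsTree.prefix-closed isTree u⊑v v∈ι , refl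
    ... | nothing with ∗-maximal (IsTree.prefix-closed isTree u⊑v v∈ι) lab v∈ι u⊑v
    ...   | refl with trans (sym lab) labv
    ...     | ()

  module FragmentedTree (π : FFT A) where
    open IsFFT (proj₂ π)

    private
      τ : LTree A A
      τ = tree (proj₁ π)

      _∼_ : Word A → Word A → Set
      _∼_ = _~_ (proj₁ π)

    []-isRoot : IsRoot A π []
    []-isRoot = IsTree.root isTree , λ v _ → []⊑ v

    block-root : ∀ {w} → node τ w → Σ (Word A) λ m → IsRoot A π m × m ∼ w
    block-root w∈τ with FragmentationProps.minimum (blocks _ w∈τ)
    ... | m , w∼m , minimal =
      m , (proj₂ (~-nodes w∼m) , λ v m∼v → minimal v (~-trans w∼m m∼v)) , ~-sym w∼m

    block-convex : ∀ {m u w} → m ∼ w → _⊑_ A m u → _⊑_ A u w → m ∼ u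
    block-convex {m} {u} {w} m∼w =
      FragmentationProps.convex (blocks m m∈τ) m u w (~-refl m∈τ) m∼w
      where
      m∈τ = proj₁ (~-nodes m∼w)

    isRoot-⊑-block : ∀ {u w w′} → IsRoot A π u → _⊑_ A u w → w ∼ w′ → _⊑_ A u w′
    isRoot-⊑-block {u} {w} {w′} u-root u⊑w w∼w′ with block-root (proj₁ (~-nodes w∼w′))
    ... | m , m-root , m∼w with ⊑-comparable u⊑w (proj₂ m-root w m∼w)
    ...   | inj₁ u⊑m = ⊑-trans u⊑m (proj₂ m-root w′ (~-trans m∼w w∼w′))
    ...   | inj₂ m⊑u = proj₂ u-root w′ (~-trans (~-sym (block-convex m∼w m⊑u u⊑w)) (~-trans m∼w w∼w′))

    root-block-or-below-child : ∀ {w} → node τ w →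
      [] ∼ w ⊎ Σ (Word A) λ u → _◁_ A π [] u × _⊑_ A u w
    root-block-or-below-child {w} = by-snoc (reverseView w)
      where
      by-snoc : ∀ {w} → Reverse w → node τ w → [] ∼ w ⊎ Σ (Word A) λ u → _◁_ A π [] u × _⊑_ A u w
      by-snoc [] []∈τ = inj₁ (~-refl []∈τ)
      by-snoc (w ∶ rw ∶ʳ i) w∷ʳi∈τ with by-snoc rw (IsTree.prefix-closed isTree (⊑-++ w [ i ]) w∷ʳi∈τ)
      ... | inj₂ (u , []◁u , u⊑w) = inj₂ (u , []◁u , ⊑-trans u⊑w (⊑-++ w [ i ]))
      ... | inj₁ []∼w with block-root w∷ʳi∈τ
      ...   | m , m-root , m∼w∷ʳi with ⊑-∷ʳ w i (proj₂ m-root _ m∼w∷ʳi)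
      ...     | inj₁ m⊑w = inj₁ (~-trans (block-convex []∼w ([]⊑ m) m⊑w) m∼w∷ʳi)
      ...     | inj₂ refl =
        inj₂ (w ∷ʳ i , ([]-isRoot , m-root , ([]⊑ _ , λ eq → ∷ʳ≢[] w i (sym eq)) , no-root-between) ,
              ⊑-refl _)
        where
        no-root-between : ∀ u → IsRoot A π u → _⊏_ A [] u → _⊏_ A u (w ∷ʳ i) → ⊥
        no-root-between u u-root (_ , []≢u) (u⊑w∷ʳi , u≢w∷ʳi) with ⊑-∷ʳ w i u⊑w∷ʳi
        ... | inj₂ u≡w∷ʳi = u≢w∷ʳi u≡w∷ʳi
        ... | inj₁ u⊑w =
          []≢u (⊑-antisym ([]⊑ u) (proj₂ u-root [] (~-sym (block-convex []∼w ([]⊑ u) u⊑w))))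

  module DestructsTo (π : FFT A) (x : 𝒯 A (FFT A)) (destruct≈ : _≈𝒯_ A (destruct A π) x) where
    open IsFFT (proj₂ π)
    open FragmentedTree π public

    private
      ι : NWTree A
      ι = proj₁ (proj₁ x)

      τ : LTree A A
      τ = tree (proj₁ π)

      _∼_ : Word A → Word A → Set
      _∼_ = _~_ (proj₁ π)

      same-nodes : ∀ w → _⟺_ A (node (tf A π []) w) (T (nnode ι w))
      same-nodes = proj₁ (proj₁ destruct≈)

      same-labels : ∀ w (p : node (tf A π []) w) (q : T (nnode ι w)) → label (tf A π []) w p ≡ nlabel ι w
      same-labels = proj₂ (proj₁ destruct≈)

    root-block⇒labelled : ∀ {w} → [] ∼ w → (w∈τ : node τ w) → Labelled ι w (label τ w w∈τ)
    root-block⇒labelled {w} []∼w w∈τ =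
      w∈ι , trans (sym (same-labels w (inj₁ []∼w) w∈ι)) (cong just (IsTree.label-irrelevant isTree w _ w∈τ))
      where
      w∈ι = proj₁ (same-nodes w) (inj₁ []∼w)

    labelled⇒root-block : ∀ {w a} → Labelled ι w a → [] ∼ w
    labelled⇒root-block {w} (w∈ι , w-lab) = from-fragment (proj₂ (same-nodes w) w∈ι)
      where
      from-fragment : node (tf A π []) w → [] ∼ w
      from-fragment (inj₁ []∼w) = []∼w
      from-fragment (inj₂ w-child) with trans (same-labels w (inj₂ w-child) w∈ι) w-lab
      ... | ()

    child⇒nwleaf : ∀ {u} → _◁_ A π [] u → nwleaf A ι u
    child⇒nwleaf {u} []◁u = nwleaf-intro ι u u∈ι (sym (same-labels u u-in-fragment u∈ι))
      where
      u-in-fragment : node (tf A π []) u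
      u-in-fragment = inj₂ ((λ u≡[] → proj₂ (proj₁ (proj₂ (proj₂ []◁u))) (sym u≡[])) , []◁u)
      u∈ι = proj₁ (same-nodes u) u-in-fragment

    subtree-at-nwleaf : ∀ {u} (q : nwleaf A ι u) → _≈F_ A (st A π u) (proj₁ (proj₂ x u q))
    subtree-at-nwleaf {u} q = proj₂ destruct≈ u (u-in-fragment , trans (same-labels u u-in-fragment u∈ι) u∗) q
      where
      u∈ι = proj₁ (nwleaf-elim ι u q)
      u∗ = proj₂ (nwleaf-elim ι u q)
      u-in-fragment = proj₂ (same-nodes u) u∈ι

  -- Uniqueness

  record EmbedsAt (π ρ : RawFFT A) (w : Word A) : Set where
    field
      node⇒  : node (tree π) w → node (tree ρ) w
      label≡ : ∀ p q → label (tree π) w p ≡ label (tree ρ) w q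
      block⇒ : ∀ v → _~_ π w v → _~_ ρ w v
  open EmbedsAt

  EmbedsAt-trans : ∀ {π ρ σ w} → EmbedsAt π ρ w → EmbedsAt ρ σ w → EmbedsAt π σ w
  EmbedsAt-trans πρ ρσ = record
    { node⇒  = λ p → node⇒ ρσ (node⇒ πρ p)
    ; label≡ = λ p q → trans (label≡ πρ p (node⇒ πρ p)) (label≡ ρσ (node⇒ πρ p) q)
    ; block⇒ = λ v w∼v → block⇒ ρσ v (block⇒ πρ v w∼v) }

  ≈F⇒EmbedsAt : ∀ {π ρ} → _≈F_ A π ρ → ∀ w → EmbedsAt π ρ w
  ≈F⇒EmbedsAt ((same-nodes , same-labels) , same-blocks) w = record
    { node⇒  = proj₁ (same-nodes w)
    ; label≡ = same-labels w
    ; block⇒ = λ v → proj₁ (same-blocks w v) }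

  ≈F⇒EmbedsAt˘ : ∀ {π ρ} → _≈F_ A π ρ → ∀ w → EmbedsAt ρ π w
  ≈F⇒EmbedsAt˘ ((same-nodes , same-labels) , same-blocks) w = record
    { node⇒  = proj₂ (same-nodes w)
    ; label≡ = λ p q → sym (same-labels w q p)
    ; block⇒ = λ v → proj₂ (same-blocks w v) }

  mutual-embedding⇒≈F : ∀ {π ρ} → (∀ w → EmbedsAt π ρ w) → (∀ w → EmbedsAt ρ π w) → _≈F_ A π ρ
  mutual-embedding⇒≈F πρ ρπ =
    ((λ w → node⇒ (πρ w) , node⇒ (ρπ w)) , λ w → label≡ (πρ w)) ,
    λ w v → block⇒ (πρ w) v , block⇒ (ρπ w) v

  EmbedsAt-from-node : ∀ {π : FFT A} {ρ w} →
                       (node (tree (proj₁ π)) w → EmbedsAt (proj₁ π) ρ w) → EmbedsAt (proj₁ π) ρ w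
  EmbedsAt-from-node {π} at-node = record
    { node⇒  = λ p → node⇒ (at-node p) p
    ; label≡ = λ p → label≡ (at-node p) p
    ; block⇒ = λ v w∼v → block⇒ (at-node (proj₁ (IsFFT.~-nodes (proj₂ π) w∼v))) v w∼v }

  EmbedsAt-from-st : ∀ {π ρ : FFT A} {u v} → IsRoot A π u →
                     EmbedsAt (st A π u) (st A ρ u) v → EmbedsAt (proj₁ π) (proj₁ ρ) (u ++ v)
  EmbedsAt-from-st {π} {ρ} {u} {v} u-root below-u = record
    { node⇒  = node⇒ below-u
    ; label≡ = label≡ below-u
    ; block⇒ = block }
    where
    block : ∀ v′ → _~_ (proj₁ π) (u ++ v) v′ → _~_ (proj₁ ρ) (u ++ v) v′
    block v′ uv∼v′ with FragmentedTree.isRoot-⊑-block π u-root (⊑-++ u v) uv∼v′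
    ... | v″ , refl = block⇒ below-u v″ uv∼v′

  module Uniqueness {C : Set₁} (α : C → 𝒯 A C) {g h : C → FFT A}
                    (g-mor : IsCoalgebraMorphism A α g) (h-mor : IsCoalgebraMorphism A α h) where

    module _ (c : C) where
      private
        module G = DestructsTo (g c) (𝒯map A g (α c)) (g-mor c)
        module H = DestructsTo (h c) (𝒯map A h (α c)) (h-mor c)
        module Fg = IsFFT (proj₂ (g c))
        module Fh = IsFFT (proj₂ (h c))

        _∼g_ _∼h_ : Word A → Word A → Set
        _∼g_ = _~_ (proj₁ (g c))
        _∼h_ = _~_ (proj₁ (h c))

      root-block-embeds : ∀ {w} → [] ∼g w → EmbedsAt (proj₁ (g c)) (proj₁ (h c)) w
      root-block-embeds {w} []∼w = record
        { node⇒  = λ _ → proj₂ (Fh.~-nodes (to-h []∼w))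
        ; label≡ = λ p q → just-injective (trans (sym (proj₂ (G.root-block⇒labelled []∼w p)))
                                                 (proj₂ (H.root-block⇒labelled (to-h []∼w) q)))
        ; block⇒ = λ v w∼v → Fh.~-trans (Fh.~-sym (to-h []∼w)) (to-h (Fg.~-trans []∼w w∼v)) }
        where
        to-h : ∀ {v} → [] ∼g v → [] ∼h v
        to-h []∼v = H.labelled⇒root-block (G.root-block⇒labelled []∼v (proj₂ (Fg.~-nodes []∼v)))

      embeds-via-children : ∀ w →
        (∀ u v (q : nwleaf A (proj₁ (proj₁ (α c))) u) → u ++ v ≡ w →
           EmbedsAt (proj₁ (g (proj₂ (α c) u q))) (proj₁ (h (proj₂ (α c) u q))) v) →
        EmbedsAt (proj₁ (g c)) (proj₁ (h c)) w
      embeds-via-children w children-embed =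
        EmbedsAt-from-node {g c} λ w∈g → by-cases (G.root-block-or-below-child w∈g)
        where
        by-cases : [] ∼g w ⊎ Σ (Word A) (λ u → _◁_ A (g c) [] u × _⊑_ A u w) →
                   EmbedsAt (proj₁ (g c)) (proj₁ (h c)) w
        by-cases (inj₁ []∼w) = root-block-embeds []∼w
        by-cases (inj₂ (u , []◁u , v , refl)) =
          EmbedsAt-from-st {g c} {h c} (proj₁ (proj₂ []◁u))
            (EmbedsAt-trans (≈F⇒EmbedsAt (G.subtree-at-nwleaf q) v)
              (EmbedsAt-trans (children-embed u v q refl) (≈F⇒EmbedsAt˘ (H.subtree-at-nwleaf q) v)))
          where
          q = G.child⇒nwleaf []◁u

    embeds : ∀ n c w → length w < n → EmbedsAt (proj₁ (g c)) (proj₁ (h c)) w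
    embeds (suc n) c w (s≤s |w|≤n) = embeds-via-children c w λ u v q u++v≡w →
      embeds n (proj₂ (α c) u q) v
        (<-≤-trans (length-++-<ʳ v (nwleaf≢[] (proj₂ (proj₁ (α c))) q))
                   (subst (λ w → length w ≤ n) (sym u++v≡w) |w|≤n))

  morphisms-agree : ∀ {C : Set₁} (α : C → 𝒯 A C) {g h} →
                    IsCoalgebraMorphism A α g → IsCoalgebraMorphism A α h → ∀ c → _≈FFT_ A (g c) (h c)
  morphisms-agree α g-mor h-mor c =
    mutual-embedding⇒≈F (λ w → Uniqueness.embeds α g-mor h-mor _ c w (n<1+n (length w)))
                        (λ w → Uniqueness.embeds α h-mor g-mor _ c w (n<1+n (length w)))

  -- Existence: unfolding a coalgebra

  module Unfold (C : Set₁) (α : C → 𝒯 A C) where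
    open ≡-Reasoning

    ι : C → NWTree A
    ι c = proj₁ (proj₁ (α c))

    ι-isNWT : ∀ c → IsNWT A (ι c)
    ι-isNWT c = proj₂ (proj₁ (α c))

    child : (c : C) (u : Word A) → nwleaf A (ι c) u → C
    child c = proj₂ (α c)

    child-irrelevant : ∀ c u (q q′ : nwleaf A (ι c) u) → child c u q ≡ child c u q′
    child-irrelevant c u q q′ = cong (child c u) (T-irrelevant q q′)

    rootLabel : C → A
    rootLabel c = proj₁ (root-labelled (ι-isNWT c))

    -- While walking, ι (source s) is the fragment being traversed, base s the position of its root
    -- in the unfolding, and offset s the current position inside it, labelled symbol s.
    record State : Set₁ where
      constructor ⟨_,_,_,_⟩
      field
        source : C
        base   : Word A
        offset : Word A
        symbol : A
    open State

    enter : C → Word A → State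
    enter c r = ⟨ c , r , [] , rootLabel c ⟩

    rebase : Word A → State → State
    rebase r s = ⟨ source s , r ++ base s , offset s , symbol s ⟩

    move : (s : State) (u : Word A) → Shape (ι (source s)) u → Maybe State
    move s u (outside _)  = nothing
    move s u (inner a _)  = just ⟨ source s , base s , u , a ⟩
    move s u (starred q)  = just (enter (child (source s) u q) (base s ++ u))

    step : State → ℕ → Maybe State
    step s i = move s (offset s ∷ʳ i) (shape (ι (source s)) (offset s ∷ʳ i))

    walk : State → Word A → Maybe State
    walk s []      = just s
    walk s (i ∷ w) = step s i >>= λ s′ → walk s′ w

    walk-++ : ∀ s w v → walk s (w ++ v) ≡ (walk s w >>= λ s′ → walk s′ v)
    walk-++ s []      v = refl
    walk-++ s (i ∷ w) v with step s i
    ... | nothing = refl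
    ... | just s′ = walk-++ s′ w v

    walk-∷ʳ : ∀ s w i → walk s (w ∷ʳ i) ≡ (walk s w >>= λ s′ → step s′ i)
    walk-∷ʳ s [] i with step s i
    ... | nothing = refl
    ... | just _  = refl
    walk-∷ʳ s (j ∷ w) i with step s j
    ... | nothing = refl
    ... | just s′ = walk-∷ʳ s′ w i

    step-rebase : ∀ r s i → step (rebase r s) i ≡ map (rebase r) (step s i)
    step-rebase r s i with shape (ι (source s)) (offset s ∷ʳ i)
    ... | outside _ = refl
    ... | inner _ _ = refl
    ... | starred q = cong (λ b → just (enter (child (source s) (offset s ∷ʳ i) q) b)) (++-assoc r (base s) _)

    walk-rebase : ∀ r s v → walk (rebase r s) v ≡ map (rebase r) (walk s v)
    walk-rebase r s []      = refl
    walk-rebase r s (i ∷ v) rewrite step-rebase r s i with step s i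
    ... | nothing = refl
    ... | just s′ = walk-rebase r s′ v

    step-inner : ∀ s i {a} → Labelled (ι (source s)) (offset s ∷ʳ i) a →
                 step s i ≡ just ⟨ source s , base s , offset s ∷ʳ i , a ⟩
    step-inner s i (u∈ι , u-lab) with shape (ι (source s)) (offset s ∷ʳ i)
    ... | outside u∉ι = ⊥-elim (u∉ι u∈ι)
    ... | inner b (_ , u-lab′) =
      cong (λ b → just ⟨ source s , base s , offset s ∷ʳ i , b ⟩) (just-injective (trans (sym u-lab′) u-lab))
    ... | starred q with trans (sym (proj₂ (nwleaf-elim (ι (source s)) _ q))) u-lab
    ...   | ()

    step-starred : ∀ s i (q : nwleaf A (ι (source s)) (offset s ∷ʳ i)) →
                   step s i ≡ just (enter (child (source s) (offset s ∷ʳ i) q) (base s ++ (offset s ∷ʳ i)))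
    step-starred s i q with shape (ι (source s)) (offset s ∷ʳ i)
    ... | outside u∉ι = ⊥-elim (u∉ι (proj₁ (nwleaf-elim (ι (source s)) _ q)))
    ... | inner b (_ , u-lab) with trans (sym (proj₂ (nwleaf-elim (ι (source s)) _ q))) u-lab
    ...   | ()
    step-starred s i q | starred q′ =
      cong (λ c → just (enter c (base s ++ (offset s ∷ʳ i)))) (child-irrelevant (source s) _ q′ q)

    walk-within : ∀ {c r u a} → Labelled (ι c) u a → walk (enter c r) u ≡ just ⟨ c , r , u , a ⟩
    walk-within {c} {r} {u} = by-snoc (reverseView u)
      where
      by-snoc : ∀ {u a} → Reverse u → Labelled (ι c) u a → walk (enter c r) u ≡ just ⟨ c , r , u , a ⟩
      by-snoc [] (_ , root-lab) =
        cong (λ a → just ⟨ c , r , [] , a ⟩)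
             (just-injective (trans (sym (proj₂ (proj₂ (root-labelled (ι-isNWT c))))) root-lab))
      by-snoc {a = a} (u ∶ ru ∶ʳ i) u∷ʳi-lab with prefix-labelled (ι-isNWT c) u∷ʳi-lab (⊑-++ u [ i ])
      ... | b , u-lab = begin
        walk (enter c r) (u ∷ʳ i)                  ≡⟨ walk-∷ʳ (enter c r) u i ⟩
        (walk (enter c r) u >>= λ s → step s i)    ≡⟨ cong (_>>= λ s → step s i) (by-snoc ru u-lab) ⟩
        step ⟨ c , r , u , b ⟩ i                   ≡⟨ step-inner ⟨ c , r , u , b ⟩ i u∷ʳi-lab ⟩
        just ⟨ c , r , u ∷ʳ i , a ⟩                ∎

    -- Opaque so that c and w can be inferred from hypotheses of the form run c w ≡ just s.
    opaque
      run : C → Word A → Maybe State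
      run c = walk (enter c [])

      run-[] : ∀ c → run c [] ≡ just (enter c [])
      run-[] c = refl

      run-++ : ∀ c w v → run c (w ++ v) ≡ (run c w >>= λ s → walk s v)
      run-++ c = walk-++ (enter c [])

      run-∷ʳ : ∀ c w i → run c (w ∷ʳ i) ≡ (run c w >>= λ s → step s i)
      run-∷ʳ c = walk-∷ʳ (enter c [])

      run-within : ∀ {c u a} → Labelled (ι c) u a → run c u ≡ just ⟨ c , [] , u , a ⟩
      run-within = walk-within

      walk-enter : ∀ c r v → walk (enter c r) v ≡ map (rebase r) (run c v)
      walk-enter c r v = begin
        walk (enter c r) v              ≡⟨ cong (λ r′ → walk (enter c r′) v) (sym (++-identityʳ r)) ⟩
        walk (rebase r (enter c [])) v  ≡⟨ walk-rebase r (enter c []) v ⟩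
        map (rebase r) (run c v)        ∎

    step-defined⟺node : ∀ s i → _⟺_ A (T (is-just (step s i))) (T (nnode (ι (source s)) (offset s ∷ʳ i)))
    step-defined⟺node s i with shape (ι (source s)) (offset s ∷ʳ i)
    ... | outside u∉ι       = (λ ()) , λ u∈ι → ⊥-elim (u∉ι u∈ι)
    ... | inner _ (u∈ι , _) = (λ _ → u∈ι) , _
    ... | starred q         = (λ _ → proj₁ (nwleaf-elim (ι (source s)) _ q)) , _

    BelowNwleaf : C → Word A → Set
    BelowNwleaf c r = Σ (Word A) λ u → nwleaf A (ι c) u × _⊑_ A u r

    record Reached (c : C) (w : Word A) (s : State) : Set₁ where
      field
        labelled : Labelled (ι (source s)) (offset s) (symbol s)
        splits   : base s ++ offset s ≡ w
        entered  : run c (base s) ≡ just (enter (source s) (base s))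
        -- needed to recognise the children of the root of the unfolding as *-leaves of ι c
        origin   : (base s ≡ [] × source s ≡ c) ⊎ BelowNwleaf c (base s)
    open Reached

    splits-∷ʳ : ∀ {c w s} i → Reached c w s → base s ++ (offset s ∷ʳ i) ≡ w ∷ʳ i
    splits-∷ʳ {s = s} i r = trans (sym (++-assoc (base s) (offset s) [ i ])) (cong (_∷ʳ i) (splits r))

    reached-∷ʳ : ∀ {c w s s′} i → Reached c w s → run c (w ∷ʳ i) ≡ step s i → step s i ≡ just s′ →
                 Reached c (w ∷ʳ i) s′
    reached-∷ʳ {c} {w} {s} i r run-step step≡ with shape (ι (source s)) (offset s ∷ʳ i) | step≡
    ... | inner a u-lab | refl = record
      { labelled = u-lab ; splits = splits-∷ʳ i r ; entered = entered r ; origin = origin r }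
    ... | starred q | refl = record
      { labelled = proj₂ (root-labelled (ι-isNWT _))
      ; splits   = trans (++-identityʳ _) (splits-∷ʳ i r)
      ; entered  = trans (cong (run c) (splits-∷ʳ i r)) run-step
      ; origin   = inj₂ (origin-∷ʳ (origin r)) }
      where
      u = offset s ∷ʳ i
      origin-∷ʳ : (base s ≡ [] × source s ≡ c) ⊎ BelowNwleaf c (base s) → BelowNwleaf c (base s ++ u)
      origin-∷ʳ (inj₁ (base≡[] , source≡c)) =
        u , subst (λ c′ → nwleaf A (ι c′) u) source≡c q ,
        subst (λ b → _⊑_ A u (b ++ u)) (sym base≡[]) (⊑-refl u)
      origin-∷ʳ (inj₂ (u′ , q′ , u′⊑base)) = u′ , q′ , ⊑-trans u′⊑base (⊑-++ (base s) u)

    reached : ∀ {c w s} → run c w ≡ just s → Reached c w s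
    reached {c} {w} = by-snoc (reverseView w)
      where
      by-snoc : ∀ {w s} → Reverse w → run c w ≡ just s → Reached c w s
      by-snoc [] run-[]≡ with just-injective (trans (sym (run-[] c)) run-[]≡)
      ... | refl = record
        { labelled = proj₂ (root-labelled (ι-isNWT c))
        ; splits   = refl
        ; entered  = run-[] c
        ; origin   = inj₁ (refl , refl) }
      by-snoc (w ∶ rw ∶ʳ i) run-w∷ʳi with run c w in run-w | run-∷ʳ c w i
      ... | nothing | run-w∷ʳi≡nothing with trans (sym run-w∷ʳi≡nothing) run-w∷ʳi
      ...   | ()
      by-snoc (w ∶ rw ∶ʳ i) run-w∷ʳi | just s | run-w∷ʳi≡step =
        reached-∷ʳ i (by-snoc rw run-w) run-w∷ʳi≡step (trans (sym run-w∷ʳi≡step) run-w∷ʳi)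

    run-at-nwleaf : ∀ {c u} (q : nwleaf A (ι c) u) → run c u ≡ just (enter (child c u q) u)
    run-at-nwleaf {c} {u} = by-snoc (reverseView u)
      where
      by-snoc : ∀ {u} → Reverse u → (q : nwleaf A (ι c) u) → run c u ≡ just (enter (child c u q) u)
      by-snoc [] q = ⊥-elim (nwleaf≢[] (ι-isNWT c) q refl)
      by-snoc (w ∶ _ ∶ʳ i) q
        with proper-prefix-labelled (ι-isNWT c) (proj₁ (nwleaf-elim (ι c) _ q)) (⊑-++ w [ i ]) (≢-∷ʳ w i)
      ... | a , w-lab = begin
        run c (w ∷ʳ i)                        ≡⟨ run-∷ʳ c w i ⟩
        (run c w >>= λ s → step s i)          ≡⟨ cong (_>>= λ s → step s i) (run-within w-lab) ⟩
        step ⟨ c , [] , w , a ⟩ i             ≡⟨ step-starred ⟨ c , [] , w , a ⟩ i q ⟩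
        just (enter (child c (w ∷ʳ i) q) (w ∷ʳ i)) ∎

    run-below-nwleaf : ∀ {c u} (q : nwleaf A (ι c) u) v → run c (u ++ v) ≡ map (rebase u) (run (child c u q) v)
    run-below-nwleaf {c} {u} q v = begin
      run c (u ++ v)                        ≡⟨ run-++ c u v ⟩
      (run c u >>= λ s → walk s v)          ≡⟨ cong (_>>= λ s → walk s v) (run-at-nwleaf q) ⟩
      walk (enter (child c u q) u) v        ≡⟨ walk-enter (child c u q) u v ⟩
      map (rebase u) (run (child c u q) v)  ∎

    fragment : C → Word A → Maybe (Word A)
    fragment c w = map base (run c w)

    unfold-raw : C → RawFFT A
    unfold-raw c = record
      { tree = record { node = λ w → T (is-just (run c w)) ; label = λ w p → symbol (extract (run c w) p) }
      ; _~_  = λ w v → T (is-just (run c w)) × fragment c w ≡ fragment c v }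

    label-at : ∀ {c w s} → run c w ≡ just s → ∀ p → label (tree (unfold-raw c)) w p ≡ symbol s
    label-at run-w p = cong symbol (extract-≡ run-w p)

    module _ {c : C} where
      private
        _∼_ : Word A → Word A → Set
        _∼_ = _~_ (unfold-raw c)

      ∼-intro : ∀ {w v s s′} → run c w ≡ just s → run c v ≡ just s′ → base s ≡ base s′ → w ∼ v
      ∼-intro run-w run-v same-base =
        ≡just⇒is-just run-w , trans (map-just run-w) (trans (cong just same-base) (sym (map-just run-v)))

      ∼-elim : ∀ {w v s} → w ∼ v → run c w ≡ just s →
               Σ State λ s′ → run c v ≡ just s′ × base s ≡ base s′
      ∼-elim {w} {v} (_ , same-fragment) run-w with run c v | trans (sym (map-just run-w)) same-fragment
      ... | just s′ | base≡ = s′ , refl , just-injective base≡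

      same-base⇒same-source : ∀ {w v s s′} → run c w ≡ just s → run c v ≡ just s′ → base s ≡ base s′ →
                              source s ≡ source s′
      same-base⇒same-source {s = s} {s′} run-w run-v same-base =
        cong source (just-injective (begin
          just (enter (source s) (base s))     ≡⟨ sym (entered (reached run-w)) ⟩
          run c (base s)                       ≡⟨ cong (run c) same-base ⟩
          run c (base s′)                      ≡⟨ entered (reached run-v) ⟩
          just (enter (source s′) (base s′))   ∎))

      module Block {w s} (run-w : run c w ≡ just s) where
        private
          c′ = source s

        run-in-block : ∀ {u a} → Labelled (ι c′) u a → run c (base s ++ u) ≡ just ⟨ c′ , base s , u , a ⟩
        run-in-block {u} u-lab = begin
          run c (base s ++ u)                    ≡⟨ run-++ c (base s) u ⟩
          (run c (base s) >>= λ s′ → walk s′ u)  ≡⟨ cong (_>>= λ s′ → walk s′ u) (entered (reached run-w)) ⟩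
          walk (enter c′ (base s)) u             ≡⟨ walk-within u-lab ⟩
          just ⟨ c′ , base s , u , _ ⟩           ∎

        block-member : ∀ {u a} → Labelled (ι c′) u a → w ∼ (base s ++ u)
        block-member u-lab = ∼-intro run-w (run-in-block u-lab) refl

        block-members : ∀ {v} → w ∼ v → Σ (Word A) λ u → v ≡ base s ++ u × Σ A (Labelled (ι c′) u)
        block-members w∼v with ∼-elim w∼v run-w
        ... | s′ , run-v , same-base =
          offset s′ ,
          trans (sym (splits (reached run-v))) (cong (_++ offset s′) (sym same-base)) ,
          symbol s′ , subst (λ c″ → Labelled (ι c″) (offset s′) (symbol s′))
                            (sym (same-base⇒same-source run-w run-v same-base)) (labelled (reached run-v))

        ∼-base : w ∼ base s
        ∼-base = ∼-intro run-w (entered (reached run-w)) refl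

        block-fragmentation : FragmentationProps A (w ∼_)
        block-fragmentation = record { finite = finite ; minimum = minimum ; convex = convex }
          where
          labelled? : ∀ u → Dec (T (is-just (nlabel (ι c′) u)))
          labelled? u = T? (is-just (nlabel (ι c′) u))

          nodes = IsNWT.finite (ι-isNWT c′)

          members : List (Word A)
          members = List.map (base s ++_) (filter labelled? (proj₁ nodes))

          listed : ∀ {v} → w ∼ v → v ∈ members
          listed w∼v with block-members w∼v
          ... | u , refl , a , u∈ι , u-lab =
            ∈-map⁺ (base s ++_)
                   (∈-filter⁺ labelled? (proj₁ (proj₂ nodes u) u∈ι) (subst (T ∘ is-just) (sym u-lab) _))

          unlisted : ∀ {v} → v ∈ members → w ∼ v
          unlisted v∈ with ∈-map⁻ (base s ++_) v∈
          ... | u , u∈ , refl with ∈-filter⁻ labelled? u∈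
          ...   | u∈xs , u-lab = block-member (proj₂ (proj₂ nodes u) u∈xs , ≡just-extract _ u-lab)

          finite : Finite A (w ∼_)
          finite = members , λ v → listed , unlisted

          minimum : Σ (Word A) λ m → w ∼ m × (∀ v → w ∼ v → _⊑_ A m v)
          minimum = base s , ∼-base ,
                    λ v w∼v → proj₁ (block-members w∼v) , sym (proj₁ (proj₂ (block-members w∼v)))

          convex : ∀ x y z → w ∼ x → w ∼ z → _⊑_ A x y → _⊑_ A y z → w ∼ y
          convex x y z w∼x w∼z (d , refl) (e , refl) with block-members w∼x | block-members w∼z
          ... | ux , refl , _ | uz , z≡ , _ , uz-lab =
            subst (w ∼_) (sym (++-assoc (base s) ux d))
                  (block-member (proj₂ (prefix-labelled (ι-isNWT c′) uz-lab (e , uy++e≡uz))))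
            where
            uy++e≡uz : (ux ++ d) ++ e ≡ uz
            uy++e≡uz = ++-cancelˡ (base s) _ _ (begin
              base s ++ ((ux ++ d) ++ e)    ≡⟨ sym (++-assoc (base s) (ux ++ d) e) ⟩
              (base s ++ (ux ++ d)) ++ e    ≡⟨ cong (_++ e) (sym (++-assoc (base s) ux d)) ⟩
              ((base s ++ ux) ++ d) ++ e    ≡⟨ z≡ ⟩
              base s ++ uz                  ∎)

      run-∷ʳ-step : ∀ {w s} i → run c w ≡ just s → run c (w ∷ʳ i) ≡ step s i
      run-∷ʳ-step {w} i run-w = trans (run-∷ʳ c w i) (cong (_>>= λ s → step s i) run-w)

      defined-prefix : ∀ w d → T (is-just (run c (w ++ d))) → T (is-just (run c w))
      defined-prefix w d with run c w | run-++ c w d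
      ... | just _  | _                = _
      ... | nothing | run-w++d≡nothing = subst (T ∘ is-just) run-w++d≡nothing

      fragment-defined : ∀ {w v} → fragment c w ≡ fragment c v → T (is-just (run c w)) → T (is-just (run c v))
      fragment-defined {w} {v} same-fragment = subst T (begin
        is-just (run c w)       ≡⟨ sym (is-just-map base (run c w)) ⟩
        is-just (fragment c w)  ≡⟨ cong is-just same-fragment ⟩
        is-just (fragment c v)  ≡⟨ is-just-map base (run c v) ⟩
        is-just (run c v)       ∎)

      unfold-isTree : IsTree A (tree (unfold-raw c))
      unfold-isTree = record
        { root               = ≡just⇒is-just (run-[] c)
        ; prefix-closed      = λ { {w} (d , refl) → defined-prefix w d }
        ; finitely-branching = branching
        ; label-irrelevant   = λ w p q → cong (symbol ∘ extract (run c w)) (T-irrelevant p q) }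
        where
        Arity : Word A → Set
        Arity w = Σ ℕ λ k → ∀ i → _⟺_ A (T (is-just (run c (w ∷ʳ i)))) (i < k)

        branching-at : ∀ {w s} → run c w ≡ just s → Arity w
        branching-at {w} {s} run-w
          with IsTree.finitely-branching (IsNWT.isTree (ι-isNWT (source s))) (proj₁ (labelled (reached run-w)))
        ... | k , arity = k , λ i →
          proj₁ (arity i) ∘ proj₁ (step-defined⟺node s i) ∘ subst (T ∘ is-just) (run-∷ʳ-step i run-w) ,
          subst (T ∘ is-just) (sym (run-∷ʳ-step i run-w)) ∘ proj₂ (step-defined⟺node s i) ∘ proj₂ (arity i)

        branching : ∀ {w} → T (is-just (run c w)) → Arity w
        branching {w} w∈ = branching-at (≡just-extract (run c w) w∈)

      unfold-isFFT : IsFFT A (unfold-raw c)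
      unfold-isFFT = record
        { isTree  = unfold-isTree
        ; ~-nodes = λ (w∈ , same-fragment) → w∈ , fragment-defined same-fragment w∈
        ; ~-refl  = λ w∈ → w∈ , refl
        ; ~-sym   = λ (w∈ , same-fragment) → fragment-defined same-fragment w∈ , sym same-fragment
        ; ~-trans = λ (w∈ , same-fragment) (_ , same-fragment′) → w∈ , trans same-fragment same-fragment′
        ; blocks  = λ w w∈ → Block.block-fragmentation (≡just-extract (run c w) w∈) }

    unfold : C → FFT A
    unfold c = unfold-raw c , unfold-isFFT

    module _ {c : C} where
      open FragmentedTree (unfold c) using ([]-isRoot)
      private
        module Root = Block {c} (run-[] c)

      base⇒isRoot : ∀ {w s} → run c w ≡ just s → base s ≡ w → IsRoot A (unfold c) w
      base⇒isRoot run-w refl =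
        ≡just⇒is-just run-w ,
        λ v w∼v → proj₁ (Block.block-members run-w w∼v) , sym (proj₁ (proj₂ (Block.block-members run-w w∼v)))

      isRoot⇒base : ∀ {w s} → IsRoot A (unfold c) w → run c w ≡ just s → base s ≡ w
      isRoot⇒base {s = s} (_ , minimal) run-w =
        ⊑-antisym (offset s , splits (reached run-w)) (minimal (base s) (Block.∼-base run-w))

      child⇒nwleaf : ∀ {v} → _◁_ A (unfold c) [] v → nwleaf A (ι c) v
      child⇒nwleaf {v} (_ , v-root , (_ , []≢v) , no-root-between) = from-origin (origin (reached run-v))
        where
        run-v = ≡just-extract (run c v) (proj₁ v-root)
        base≡v = isRoot⇒base v-root run-v
        from-origin : _ → nwleaf A (ι c) v
        from-origin (inj₁ (base≡[] , _)) = ⊥-elim ([]≢v (trans (sym base≡[]) base≡v))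
        from-origin (inj₂ (u , q , u⊑base)) with ≡-dec _≟_ u v
        ... | yes refl = q
        ... | no u≢v = ⊥-elim (no-root-between u (base⇒isRoot (run-at-nwleaf q) refl)
                                 ([]⊑ u , λ []≡u → nwleaf≢[] (ι-isNWT c) q (sym []≡u))
                                 (subst (_⊑_ A u) base≡v u⊑base , u≢v))

      nwleaf⇒child : ∀ {v} → nwleaf A (ι c) v → _◁_ A (unfold c) [] v
      nwleaf⇒child {v} q =
        []-isRoot , base⇒isRoot (run-at-nwleaf q) refl ,
        ([]⊑ v , λ []≡v → nwleaf≢[] (ι-isNWT c) q (sym []≡v)) , no-root-between
        where
        no-root-between : ∀ u → IsRoot A (unfold c) u → _⊏_ A [] u → _⊏_ A u v → ⊥
        no-root-between u u-root (_ , []≢u) (u⊑v , u≢v)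
          with proper-prefix-labelled (ι-isNWT c) (proj₁ (nwleaf-elim (ι c) v q)) u⊑v u≢v
        ... | _ , u-lab = []≢u (isRoot⇒base u-root (run-within u-lab))

      top-fragment : _≈t_ A (tf A (unfold c) []) (toLTree A (ι c))
      top-fragment = (λ v → to-ι , from-ι) , λ v p _ → same-label p
        where
        to-ι : ∀ {v} → node (tf A (unfold c) []) v → T (nnode (ι c) v)
        to-ι (inj₁ []∼v) with Root.block-members []∼v
        ... | _ , refl , _ , v∈ι , _ = v∈ι
        to-ι {v} (inj₂ (_ , []◁v)) = proj₁ (nwleaf-elim (ι c) v (child⇒nwleaf []◁v))

        from-ι : ∀ {v} → T (nnode (ι c) v) → node (tf A (unfold c) []) v
        from-ι {v} v∈ι with nlabel (ι c) v in v-lab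
        ... | just _  = inj₁ (Root.block-member (v∈ι , v-lab))
        ... | nothing = inj₂ ((λ v≡[] → nwleaf≢[] (ι-isNWT c) q v≡[]) , nwleaf⇒child q)
          where
          q = nwleaf-intro (ι c) v v∈ι v-lab

        same-label : ∀ {v} (p : node (tf A (unfold c) []) v) → label (tf A (unfold c) []) v p ≡ nlabel (ι c) v
        same-label (inj₁ []∼v) with Root.block-members []∼v
        ... | _ , refl , _ , v-lab = trans (cong just (label-at (run-within v-lab) _)) (sym (proj₂ v-lab))
        same-label {v} (inj₂ (_ , []◁v)) = sym (proj₂ (nwleaf-elim (ι c) v (child⇒nwleaf []◁v)))

      fragment-below-nwleaf : ∀ {u} (q : nwleaf A (ι c) u) v →
                              fragment c (u ++ v) ≡ map (u ++_) (fragment (child c u q) v)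
      fragment-below-nwleaf {u} q v = begin
        map base (run c (u ++ v))                  ≡⟨ cong (map base) (run-below-nwleaf q v) ⟩
        map base (map (rebase u) (run c′ v))       ≡⟨ sym (map-∘ (run c′ v)) ⟩
        map ((u ++_) ∘ base) (run c′ v)            ≡⟨ map-∘ (run c′ v) ⟩
        map (u ++_) (map base (run c′ v))          ∎
        where
        c′ = child c u q

      subtree-at-nwleaf : ∀ u (q : nwleaf A (ι c) u) → _≈F_ A (st A (unfold c) u) (unfold-raw (child c u q))
      subtree-at-nwleaf u q =
        ((λ v → subst T (defined≡ v) , subst T (sym (defined≡ v))) , same-label) ,
        λ v v′ → same-block v v′ , same-block˘ v v′
        where
        c′ = child c u q
        below = fragment-below-nwleaf q

        defined≡ : ∀ v → is-just (run c (u ++ v)) ≡ is-just (run c′ v)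
        defined≡ v = trans (cong is-just (run-below-nwleaf q v)) (is-just-map (rebase u) (run c′ v))

        same-label : ∀ v p p′ → label (tree (unfold-raw c)) (u ++ v) p ≡ label (tree (unfold-raw c′)) v p′
        same-label v p p′ = trans (label-at (trans (run-below-nwleaf q v) (map-just run-v)) p) (sym (label-at run-v p′))
          where
          run-v = ≡just-extract (run c′ v) p′

        same-block : ∀ v v′ → _~_ (unfold-raw c) (u ++ v) (u ++ v′) → _~_ (unfold-raw c′) v v′
        same-block v v′ (uv∈ , same-fragment) =
          subst T (defined≡ v) uv∈ ,
          map-injective (++-cancelˡ u _ _) (trans (sym (below v)) (trans same-fragment (below v′)))

        same-block˘ : ∀ v v′ → _~_ (unfold-raw c′) v v′ → _~_ (unfold-raw c) (u ++ v) (u ++ v′)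
        same-block˘ v v′ (v∈ , same-fragment) =
          subst T (sym (defined≡ v)) v∈ , trans (below v) (trans (cong (map (u ++_)) same-fragment) (sym (below v′)))

    unfold-isMorphism : IsCoalgebraMorphism A α unfold
    unfold-isMorphism c = top-fragment , λ u _ q → subtree-at-nwleaf u q

theorem2p19 : (A : Set) (C : Set₁) (α : C → 𝒯 A C) →
    Σ (C → FFT A) λ f → IsCoalgebraMorphism A α f
      × ((g : C → FFT A) → IsCoalgebraMorphism A α g → ∀ c → _≈FFT_ A (g c) (f c))
theorem2p19 A C α = unfold , unfold-isMorphism , λ g g-mor → morphisms-agree A α g-mor unfold-isMorphism
  where
  open Unfold A C α
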